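{- Let $L$ be a lattice data structure with $N$ proper keys. If the procedure $P$ performing each jump step of JumpSearchLDS runs in time $O(\log m)$ on $m$ elements, then JumpSearchLDS on $L$ runs in time $O(J(L)\log N)$.
   Context: Diagram of height $h$: cells $(r,c)$ of positive integers with $r+c\le h+4$; $r$ is the row (numbered bottom to top), $c$ the column (left to right). Diagonal $k$ ($1\le k\le h+3$) is the set of cells with $r+c=k+1$, numbered from head $(k,1)$ to tail $(1,k)$, its $j$-th cell being $(k+1-j,j)$. A lattice data structure (LDS) of height $h$ assigns to each cell an entry in $\{0,\infty\}\cup\mathbb{Z}_{>0}$ such that: (1) all cells of row $1$ and column $1$ contain $0$; (2) all cells of diagonal $h+3$ except head and tail contain $\infty$; (3) for some $0\le m\le h-1$, exactly the cells $(h+3-j,j)$ of diagonal $h+2$ with $h+2-m\le j\le h+1$ contain $\infty$; (4) all remaining cells contain pairwise distinct positive integers (proper keys); (5) proper keys are strictly increasing along each row (left to right), column (bottom to top) and diagonal (head to tail). Order convention: $0<n<\infty$. For a cell $C=(r,c)$: $D=(r-1,c)$, $DR=(r-1,c+1)$. SearchLDS($L,K$) for a positive integer $K$: start at $(h+1,2)$; repeatedly: entry $=K$ → stop; entry $=0$ → stop; else move to $DR$ (a "$d$" movement) if $K>$ entry, to $D$ (a "$D$" movement) if $K<$ entry. The search path of $K$ is the sequence of movements made until termination; $J(K;L)$ is the number of maximal blocks of consecutive identical movements in it, and $J(L)=\max\{J(K;L): K\text{ a positive integer}\}$. JumpSearchLDS($L,K$): start at $C=(h+1,2)$; while the entry of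 $C$ is neither $K$ nor $0$: if $K<C$, move $C$ down its column to the first cell (going downward) with entry $\le K$; otherwise move $C$ along its diagonal toward the tail to the first cell with entry $\ge K$, or to a cell with entry $0$ if there is none. Report present iff the final entry is $K$. Each jump is carried out by a procedure $P$ applied to the relevant sorted part of the current column or diagonal. -}

module Defs where

open import Data.Nat using (ℕ; zero; suc; _+_; _*_; _∸_; _≤_; _<_; _≤ᵇ_; _<ᵇ_; _≡ᵇ_)
open import Data.Nat.Properties using (<-cmp)
open import Data.Bool using (Bool; true; false; _∧_; _∨_; if_then_else_; T)
open import Data.List using (List; []; _∷_; map; upTo)
open import Data.Nat.ListAction using (sum)
open import Data.Product using (_×_; _,_; ∃)
open import Relation.Binary.PropositionalEquality using (_≡_)
open import Relation.Binary.Definitions using (tri<; tri≈; tri>)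

data Ent : Set where
  zer : Ent
  key : ℕ → Ent
  inf : Ent

data _<ᴱ_ : Ent → Ent → Set where
  z<k : ∀ {n} → zer <ᴱ key n
  z<i : zer <ᴱ inf
  k<k : ∀ {m n} → m < n → key m <ᴱ key n
  k<i : ∀ {n} → key n <ᴱ inf

-- Cells (r , c), r = row (bottom to top), c = column (left to right).
-- A cell is "proper" (must carry a proper key) iff r ≥ 2, c ≥ 2 and
-- either r + c ≤ h + 2 (strictly below diagonal h+2), or it lies on
-- diagonal h+2 (r + c = h + 3) at position j = c with c < h + 2 - m,
-- i.e. not among the ∞-cells of condition (3).

proper : (h m r c : ℕ) → Bool
proper h m r c =
  (2 ≤ᵇ r) ∧ ((2 ≤ᵇ c) ∧
  ((r + c ≤ᵇ h + 2) ∨ ((r + c ≡ᵇ h + 3) ∧ (c + m <ᵇ h + 2))))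

record LDS (h : ℕ) : Set where
  field
    entry    : ℕ → ℕ → Ent
    m        : ℕ
    m<h      : m < h
    row1     : ∀ c → 1 ≤ c → 1 + c ≤ h + 4 → entry 1 c ≡ zer
    col1     : ∀ r → 1 ≤ r → r + 1 ≤ h + 4 → entry r 1 ≡ zer
    diagTop  : ∀ r c → 2 ≤ r → 2 ≤ c → r + c ≡ h + 4 → entry r c ≡ inf
    diagInf  : ∀ r c → 2 ≤ r → 2 ≤ c → r + c ≡ h + 3 → h + 2 ≤ c + m →
               entry r c ≡ inf
    properKey : ∀ r c → T (proper h m r c) → ∃ λ n → (0 < n) × (entry r c ≡ key n)
    distinct  : ∀ r c r′ c′ → T (proper h m r c) → T (proper h m r′ c′) →
                entry r c ≡ entry r′ c′ → (r ≡ r′) × (c ≡ c′)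
    rowInc   : ∀ r c c′ → T (proper h m r c) → T (proper h m r c′) →
               c < c′ → entry r c <ᴱ entry r c′
    colInc   : ∀ r r′ c → T (proper h m r c) → T (proper h m r′ c) →
               r < r′ → entry r c <ᴱ entry r′ c
    diagInc  : ∀ r c r′ c′ → T (proper h m r c) → T (proper h m r′ c′) →
               r + c ≡ r′ + c′ → c < c′ → entry r c <ᴱ entry r′ c′

open LDS public

-- N = number of proper keys of L (all cells lie in rows/columns < h + 5).
numKeys : ∀ {h} → LDS h → ℕ
numKeys {h} L =
  sum (map (λ r → sum (map (λ c → if proper h (m L) r c then 1 else 0)
                           (upTo (h + 5))))
           (upTo (h + 5)))

-- SearchLDS: the search path (list of movements).  Every movement
-- decreases the row, so we recurse on the row.

data Move : Set where
  d : Move   -- move to DR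
  D : Move   -- move to D

searchFrom : (ℕ → ℕ → Ent) → (K r c : ℕ) → List Move
searchFrom e K zero    c = []
searchFrom e K (suc r) c with e (suc r) c
... | zer   = []
... | inf   = D ∷ searchFrom e K r c
... | key n with <-cmp K n
...   | tri< _ _ _ = D ∷ searchFrom e K r c
...   | tri≈ _ _ _ = []
...   | tri> _ _ _ = d ∷ searchFrom e K r (suc c)

searchPath : ∀ {h} → LDS h → ℕ → List Move
searchPath {h} L K = searchFrom (entry L) K (h + 1) 2

sameMove : Move → Move → Bool
sameMove d d = true
sameMove D D = true
sameMove _ _ = false

blocks : List Move → ℕ
blocks []               = 0
blocks (x ∷ [])         = 1
blocks (x ∷ y ∷ xs)     =
  if sameMove x y then blocks (y ∷ xs) else suc (blocks (y ∷ xs))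

JK : ∀ {h} → LDS h → ℕ → ℕ
JK L K = blocks (searchPath L K)

IsJ : ∀ {h} → LDS h → ℕ → Set
IsJ L j = (∃ λ K → (0 < K) × (JK L K ≡ j)) × (∀ K → 0 < K → JK L K ≤ j)

-- column jump: first row (scanning downward from row r) with entry ≤ K
leK : ℕ → Ent → Bool
leK K zer     = true
leK K (key n) = n ≤ᵇ K
leK K inf     = false

downTarget : (ℕ → ℕ → Ent) → (K r c : ℕ) → ℕ
downTarget e K zero    c = zero
downTarget e K (suc r) c =
  if leK K (e (suc r) c) then suc r else downTarget e K r c

-- diagonal jump: first cell (scanning toward the tail from (r , c))
-- with entry ≥ K, or with entry 0
stopD : ℕ → Ent → Bool
stopD K zer     = true
stopD K (key n) = K ≤ᵇ n
stopD K inf     = true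

diagTarget : (ℕ → ℕ → Ent) → (K r c : ℕ) → ℕ × ℕ
diagTarget e K zero    c = (zero , c)
diagTarget e K (suc r) c =
  if stopD K (e (suc r) c) then (suc r , c) else diagTarget e K r (suc c)

-- Each loop iteration (entry inspection) costs 1 unit, plus P's
-- running time T m on the m = r - 1 cells of the column below C
-- (resp. of the diagonal from C to the tail, excluding C).
jumpCostFrom : (ℕ → ℕ) → (ℕ → ℕ → Ent) → (K fuel r c : ℕ) → ℕ
jumpCostFrom T e K zero       r c = 0
jumpCostFrom T e K (suc fuel) r c with e r c
... | zer = 1
... | inf = 1 + T (r ∸ 1) + jumpCostFrom T e K fuel (downTarget e K (r ∸ 1) c) c
... | key n with <-cmp K n
...   | tri< _ _ _ =
        1 + T (r ∸ 1) + jumpCostFrom T e K fuel (downTarget e K (r ∸ 1) c) c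
...   | tri≈ _ _ _ = 1
...   | tri> _ _ _ with diagTarget e K (r ∸ 1) (suc c)
...     | (r′ , c′) = 1 + T (r ∸ 1) + jumpCostFrom T e K fuel r′ c′

-- Every iteration strictly decreases the row, so fuel h + 1 suffices.
jumpCost : ∀ {h} → (ℕ → ℕ) → LDS h → ℕ → ℕ
jumpCost {h} T L K = jumpCostFrom T (entry L) K (h + 1) (h + 1) 2

module Submission where

-- The argument compares a run of JumpSearchLDS with the search path of
-- SearchLDS for the same key.  A column jump from a cell replays one whole
-- maximal block of D-movements of the search path, and a diagonal jump one
-- whole block of d-movements; hence the number of jumps is at most the
-- number of blocks J(K; L) ≤ J(L), and each jump (inspection plus one call
-- of P on fewer than h + 3 cells) costs at most some bound B.
--
-- Finally
-- B = O(log h) = O(log N) comes from the hypothesis T m = O(log m),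
-- which gives the theorem.

open import Defs
open import Data.Nat
open import Data.Nat.Properties
open import Data.Nat.Logarithm using (⌊log₂_⌋; ⌊log₂⌋-mono-≤; ⌊log₂[2*b]⌋≡1+⌊log₂b⌋)
open import Data.Nat.ListAction using (sum)
open import Data.Nat.Solver using (module +-*-Solver)
open import Data.Bool using (true; false; T; if_then_else_)
open import Data.Bool.Properties using (T-≡; T-∧; T-∨)
open import Data.List using ([]; _∷_; map; upTo; applyUpTo; head)
open import Data.List.Properties using (map-applyUpTo)
open import Data.Maybe using (just)
open import Data.Product using (∃; _,_; proj₁; proj₂)
open import Data.Sum using (inj₁; inj₂)
open import Data.Empty using (⊥; ⊥-elim)
open import Function using (_∘_; id; Equivalence)
open import Relation.Nullary using (yes; no)
open import Relation.Binary.PropositionalEquality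
open import Relation.Binary.Definitions using (tri<; tri≈; tri>)
open +-*-Solver using (solve; _:+_; _:*_; _:=_; con)

true≢false : ∀ {b} → b ≡ true → b ≡ false → ⊥
true≢false refl ()

≤ᵇ-true : ∀ {m n} → m ≤ n → (m ≤ᵇ n) ≡ true
≤ᵇ-true m≤n = Equivalence.to T-≡ (≤⇒≤ᵇ m≤n)

≤ᵇ-false : ∀ {m n} → n < m → (m ≤ᵇ n) ≡ false
≤ᵇ-false {m} {n} n<m with m ≤ᵇ n in eq
... | true  = ⊥-elim (<⇒≱ n<m (≤ᵇ⇒≤ m n (Equivalence.from T-≡ eq)))
... | false = refl

indicator-pos : ∀ b → T b → 1 ≤ (if b then 1 else 0)
indicator-pos true _ = s≤s z≤n

term-≤-sum : ∀ (g : ℕ → ℕ) {i n} → i < n → g i ≤ sum (applyUpTo g n)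
term-≤-sum g {zero}  {suc n} _          = m≤m+n (g 0) _
term-≤-sum g {suc i} {suc n} (s≤s i<n) =
  ≤-trans (term-≤-sum (g ∘ suc) i<n) (m≤n+m _ (g 0))

count-≤-sum : ∀ (g : ℕ → ℕ) a k n → (∀ i → i < k → 1 ≤ g (a + i)) →
              a + k ≤ n → k ≤ sum (applyUpTo g n)
count-≤-sum g zero    zero    n       _   _         = z≤n
count-≤-sum g zero    (suc k) (suc n) pos (s≤s k≤n) =
  +-mono-≤ (pos 0 z<s)
           (count-≤-sum (g ∘ suc) zero k n (λ i i<k → pos (suc i) (s<s i<k)) k≤n)
count-≤-sum g (suc a) k       (suc n) pos (s≤s a+k≤n) =
  ≤-trans (count-≤-sum (g ∘ suc) a k n pos a+k≤n) (m≤n+m _ (g 0))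

sum-map-upTo : ∀ (g : ℕ → ℕ) n → sum (map g (upTo n)) ≡ sum (applyUpTo g n)
sum-map-upTo g n = cong sum (map-applyUpTo id g n)

blocks-newBlock : ∀ μ ms → (head ms ≡ just μ → ⊥) → blocks (μ ∷ ms) ≡ suc (blocks ms)
blocks-newBlock μ []       _  = refl
blocks-newBlock d (d ∷ ms) ne = ⊥-elim (ne refl)
blocks-newBlock d (D ∷ ms) _  = refl
blocks-newBlock D (d ∷ ms) _  = refl
blocks-newBlock D (D ∷ ms) ne = ⊥-elim (ne refl)

blocks-nonempty : ∀ μ ms → 1 ≤ blocks (μ ∷ ms)
blocks-nonempty μ []       = s≤s z≤n
blocks-nonempty μ (ν ∷ ms) with sameMove μ ν
... | true  = blocks-nonempty ν ms
... | false = s≤s z≤n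

module Replay (e : ℕ → ℕ → Ent) (K : ℕ) where

  search-down : ∀ x c → leK K (e (suc x) c) ≡ false →
                searchFrom e K (suc x) c ≡ D ∷ searchFrom e K x c
  search-down x c eq with e (suc x) c | eq
  ... | inf   | _   = refl
  ... | key n | n≰K with <-cmp K n
  ...   | tri< _ _ _   = refl
  ...   | tri≈ _ K≡n _ = ⊥-elim (true≢false (≤ᵇ-true (≤-reflexive (sym K≡n))) n≰K)
  ...   | tri> _ _ K>n = ⊥-elim (true≢false (≤ᵇ-true (<⇒≤ K>n)) n≰K)

  search-notDown : ∀ x c → leK K (e (suc x) c) ≡ true →
                   head (searchFrom e K (suc x) c) ≡ just D → ⊥
  search-notDown x c eq with e (suc x) c | eq
  ... | zer   | _   = λ ()
  ... | key n | n≤K with <-cmp K n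
  ...   | tri< K<n _ _ = ⊥-elim (true≢false n≤K (≤ᵇ-false K<n))
  ...   | tri≈ _ _ _   = λ ()
  ...   | tri> _ _ _   = λ ()

  search-diag : ∀ x c → stopD K (e (suc x) c) ≡ false →
                searchFrom e K (suc x) c ≡ d ∷ searchFrom e K x (suc c)
  search-diag x c eq with e (suc x) c | eq
  ... | key n | K≰n with <-cmp K n
  ...   | tri< K<n _ _ = ⊥-elim (true≢false (≤ᵇ-true (<⇒≤ K<n)) K≰n)
  ...   | tri≈ _ K≡n _ = ⊥-elim (true≢false (≤ᵇ-true (≤-reflexive K≡n)) K≰n)
  ...   | tri> _ _ _   = refl

  search-notDiag : ∀ x c → stopD K (e (suc x) c) ≡ true →
                   head (searchFrom e K (suc x) c) ≡ just d → ⊥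
  search-notDiag x c eq with e (suc x) c | eq
  ... | zer   | _   = λ ()
  ... | inf   | _   = λ ()
  ... | key n | K≤n with <-cmp K n
  ...   | tri< _ _ _   = λ ()
  ...   | tri≈ _ _ _   = λ ()
  ...   | tri> _ _ K>n = ⊥-elim (true≢false K≤n (≤ᵇ-false K>n))

  search-moves : ∀ x c n → e (suc x) c ≡ key n → (K ≡ n → ⊥) →
                 1 ≤ blocks (searchFrom e K (suc x) c)
  search-moves x c n eq K≢n rewrite eq with <-cmp K n
  ... | tri< _ _ _   = blocks-nonempty D (searchFrom e K x c)
  ... | tri≈ _ K≡n _ = ⊥-elim (K≢n K≡n)
  ... | tri> _ _ _   = blocks-nonempty d (searchFrom e K x (suc c))

  column-blocks : ∀ x c → blocks (D ∷ searchFrom e K x c) ≡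
                          suc (blocks (searchFrom e K (downTarget e K x c) c))
  column-blocks zero    c = refl
  column-blocks (suc x) c with leK K (e (suc x) c) in eq
  ... | true  = blocks-newBlock D _ (search-notDown x c eq)
  ... | false rewrite search-down x c eq = column-blocks x c

  diagonal-blocks : ∀ x c → blocks (d ∷ searchFrom e K x c) ≡
    suc (blocks (searchFrom e K (proj₁ (diagTarget e K x c)) (proj₂ (diagTarget e K x c))))
  diagonal-blocks zero    c = refl
  diagonal-blocks (suc x) c with stopD K (e (suc x) c) in eq
  ... | true  = blocks-newBlock d _ (search-notDiag x c eq)
  ... | false rewrite search-diag x c eq = diagonal-blocks x (suc c)

  downTarget-≤ : ∀ x c → downTarget e K x c ≤ x
  downTarget-≤ zero    c = z≤n
  downTarget-≤ (suc x) c with leK K (e (suc x) c)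
  ... | true  = ≤-refl
  ... | false = m≤n⇒m≤1+n (downTarget-≤ x c)

  downTarget-pos : ∀ x c → e 1 c ≡ zer → 1 ≤ downTarget e K (suc x) c
  downTarget-pos zero    c row1≡0 rewrite row1≡0 = s≤s z≤n
  downTarget-pos (suc x) c row1≡0 with leK K (e (suc (suc x)) c)
  ... | true  = s≤s z≤n
  ... | false = downTarget-pos x c row1≡0

  diagTarget-diagonal : ∀ x c → proj₁ (diagTarget e K x c) + proj₂ (diagTarget e K x c) ≡ x + c
  diagTarget-diagonal zero    c = refl
  diagTarget-diagonal (suc x) c with stopD K (e (suc x) c)
  ... | true  = refl
  ... | false = trans (diagTarget-diagonal x (suc c)) (+-suc x c)

  diagTarget-col : ∀ x c → c ≤ proj₂ (diagTarget e K x c)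
  diagTarget-col zero    c = ≤-refl
  diagTarget-col (suc x) c with stopD K (e (suc x) c)
  ... | true  = ≤-refl
  ... | false = ≤-trans (n≤1+n c) (diagTarget-col x (suc c))

  diagTarget-pos : ∀ x c → e 1 (x + c) ≡ zer → 1 ≤ proj₁ (diagTarget e K (suc x) c)
  diagTarget-pos zero    c row1≡0 rewrite row1≡0 = s≤s z≤n
  diagTarget-pos (suc x) c row1≡0 with stopD K (e (suc (suc x)) c)
  ... | true  = s≤s z≤n
  ... | false = diagTarget-pos x (suc c) (subst (λ k → e 1 k ≡ zer) (sym (+-suc x c)) row1≡0)

module CostBound (Tm : ℕ → ℕ) (e : ℕ → ℕ → Ent) (K S : ℕ)
                 (row1-zero : ∀ c → 2 ≤ c → 1 + c ≤ S → e 1 c ≡ zer)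
                 (B : ℕ) (step-bound : ∀ x → x < S → suc (Tm x) ≤ B) where

  open Replay e K

  B-pos : 0 < S → 1 ≤ B * 1
  B-pos S>0 rewrite *-identityʳ B = ≤-trans (s≤s z≤n) (step-bound 0 S>0)

  oneMoreJump : ∀ {a x s} → a ≤ B → x ≤ B * s → a + x ≤ B * suc s
  oneMoreJump {s = s} a≤B x≤Bs rewrite *-suc B s = +-mono-≤ a≤B x≤Bs

  CostBounded : ℕ → Set
  CostBounded f = ∀ r c → 1 ≤ r → 2 ≤ c → r + c ≤ S →
                  jumpCostFrom Tm e K f r c ≤ B * suc (blocks (searchFrom e K r c))

  -- A column jump from row r + 2: the cost of the step plus the rest of the
  -- run is covered by the D-block it replays plus the blocks after it.
  columnJump : ∀ f → CostBounded f → ∀ r c → 2 ≤ c → suc (suc r) + c ≤ S →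
    suc (Tm (suc r)) + jumpCostFrom Tm e K f (downTarget e K (suc r) c) c
      ≤ B * suc (blocks (D ∷ searchFrom e K (suc r) c))
  columnJump f IH r c 2≤c inS rewrite column-blocks (suc r) c =
    oneMoreJump (step-bound (suc r) (≤-trans (m≤m+n _ c) inS))
      (IH _ c (downTarget-pos r c (row1-zero c 2≤c (≤-trans (+-monoˡ-≤ c (s≤s z≤n)) inS)))
          2≤c (≤-trans (+-monoˡ-≤ c (m≤n⇒m≤1+n (downTarget-≤ (suc r) c))) inS))

  -- A diagonal jump from row r + 2, accounted for in the same way by its d-block;
  -- the target stays in the region because it lies on the same diagonal.
  diagonalJump : ∀ f → CostBounded f → ∀ r c → 2 ≤ c → suc (suc r) + c ≤ S →
    suc (Tm (suc r)) + jumpCostFrom Tm e K f (proj₁ (diagTarget e K (suc r) (suc c)))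
                                             (proj₂ (diagTarget e K (suc r) (suc c)))
      ≤ B * suc (blocks (d ∷ searchFrom e K (suc r) (suc c)))
  diagonalJump f IH r c 2≤c inS rewrite diagonal-blocks (suc r) (suc c) =
    oneMoreJump (step-bound (suc r) (≤-trans (m≤m+n _ c) inS))
      (IH _ _ (diagTarget-pos r (suc c) (row1-zero (r + suc c) 2≤r+c+1 r+c+2≤S))
              (≤-trans (m≤n⇒m≤1+n 2≤c) (diagTarget-col (suc r) (suc c)))
              (subst (_≤ S) (sym (diagTarget-diagonal (suc r) (suc c))) r+c+2≤S))
    where
    r+c+2≤S : suc r + suc c ≤ S
    r+c+2≤S = subst (_≤ S) (sym (+-suc (suc r) c)) inS
    2≤r+c+1 : 2 ≤ r + suc c
    2≤r+c+1 = ≤-trans (m≤n⇒m≤1+n 2≤c) (m≤n+m (suc c) r)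

  jumpCost-blocks : ∀ f → CostBounded f
  jumpCost-blocks zero    r c _ _ _ = z≤n
  jumpCost-blocks (suc f) (suc zero) c _ 2≤c inS
    rewrite row1-zero c 2≤c inS = B-pos (≤-trans (s≤s z≤n) inS)
  jumpCost-blocks (suc f) (suc (suc r)) c _ 2≤c inS with e (suc (suc r)) c
  ... | zer   = B-pos (≤-trans (s≤s z≤n) inS)
  ... | inf   = columnJump f (jumpCost-blocks f) r c 2≤c inS
  ... | key n with <-cmp K n
  ...   | tri< _ _ _ = columnJump f (jumpCost-blocks f) r c 2≤c inS
  ...   | tri≈ _ _ _ = B-pos (≤-trans (s≤s z≤n) inS)
  ...   | tri> _ _ _ = diagonalJump f (jumpCost-blocks f) r c 2≤c inS

LDS-row1-zero : ∀ {h} (L : LDS h) c → 2 ≤ c → 1 + c ≤ h + 3 → entry L 1 c ≡ zer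
LDS-row1-zero {h} L c 2≤c c<h+3 =
  row1 L c (≤-trans (s≤s z≤n) 2≤c) (≤-trans c<h+3 (+-monoʳ-≤ h (n≤1+n 3)))

LDS-jumpCost : ∀ {h} (Tm : ℕ → ℕ) (L : LDS h) (B : ℕ) →
  (∀ x → x < h + 3 → suc (Tm x) ≤ B) → ∀ K → jumpCost Tm L K ≤ B * suc (JK L K)
LDS-jumpCost {h} Tm L B step-bound K =
  CostBound.jumpCost-blocks Tm (entry L) K (h + 3) (LDS-row1-zero L) B step-bound
    (h + 1) (h + 1) 2 (m≤n+m 1 h) ≤-refl (≤-reflexive (+-assoc h 1 2))

-- The start cell (h + 1, 2) lies on diagonal h + 2 before its ∞-cells, so
-- it holds a proper key.
startCell-proper : ∀ {h} (L : LDS (suc h)) → T (proper (suc h) (m L) (suc h + 1) 2)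
startCell-proper {h} L =
  Equivalence.from T-∧ (≤⇒≤ᵇ (s≤s (m≤n+m 1 h)) ,
    Equivalence.from T-∨ (inj₂ (Equivalence.from T-∧
      (≡⇒≡ᵇ _ _ (+-assoc (suc h) 1 2) ,
       <⇒<ᵇ (subst (2 + m L <_) (+-comm 2 (suc h)) (+-monoʳ-< 2 (m<h L)))))))

-- J(L) ≥ 1: searching for the start key plus one moves at least once.
J-pos : ∀ {h} (L : LDS h) j → IsJ L j → 1 ≤ j
J-pos {zero}  L j _           = ⊥-elim (n≮0 (m<h L))
J-pos {suc h} L j (_ , J-max) with properKey L (suc h + 1) 2 (startCell-proper L)
... | n , _ , start≡n =
  ≤-trans (Replay.search-moves (entry L) (suc n) (h + 1) 2 n start≡n 1+n≢n)
          (J-max (suc n) (s≤s z≤n))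

-- N ≥ h - 1: the cells (2, c) with 2 ≤ c ≤ h lie strictly below diagonal
-- h + 2, so they hold proper keys.
numKeys-height : ∀ {h} (L : LDS h) → h ≤ suc (numKeys L)
numKeys-height {zero}  L = z≤n
numKeys-height {suc h} L = s≤s (begin
    h                                          ≤⟨ count-≤-sum (isKey 2) 2 h n row2 2+h≤n ⟩
    sum (applyUpTo (isKey 2) n)                ≡⟨ sym (sum-map-upTo (isKey 2) n) ⟩
    rowCount 2                                 ≤⟨ term-≤-sum rowCount {2} {n} 2<n ⟩
    sum (applyUpTo rowCount n)                 ≡⟨ sym (sum-map-upTo rowCount n) ⟩
    numKeys L                                  ∎)
  where
  open ≤-Reasoning
  n : ℕ
  n = suc h + 5
  isKey : ℕ → ℕ → ℕ
  isKey r c = if proper (suc h) (m L) r c then 1 else 0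
  rowCount : ℕ → ℕ
  rowCount r = sum (map (isKey r) (upTo n))
  2+h≤n : 2 + h ≤ n
  2+h≤n = m≤n⇒m≤1+n (≤-trans (≤-reflexive (+-comm 2 h)) (+-monoʳ-≤ h (m≤m+n 2 3)))
  2<n : 2 < n
  2<n = ≤-trans (m≤n+m 3 (suc h + 2)) (≤-reflexive (+-assoc (suc h) 2 3))
  row2 : ∀ i → i < h → 1 ≤ isKey 2 (2 + i)
  row2 i i<h = indicator-pos (proper (suc h) (m L) 2 (2 + i))
    (Equivalence.from T-∨ (inj₁ (≤⇒≤ᵇ
      (≤-trans (+-monoʳ-≤ 2 (s≤s i<h)) (≤-reflexive (+-comm 2 (suc h)))))))

-- With M = Σ_{y < m₀} T y, the eventual bound T x ≤ c log x becomes global.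
T-bound : ∀ (Tm : ℕ → ℕ) c m₀ → (∀ x → m₀ ≤ x → Tm x ≤ c * ⌊log₂ x ⌋) →
          ∀ x → Tm x ≤ sum (applyUpTo Tm m₀) + c * ⌊log₂ x ⌋
T-bound Tm c m₀ eventually x with x <? m₀
... | yes x<m₀ = ≤-trans (term-≤-sum Tm x<m₀) (m≤m+n _ _)
... | no  x≮m₀ = ≤-trans (eventually x (≮⇒≥ x≮m₀)) (m≤n+m _ _)

-- log x ≤ 3 log N for x ≤ N + 3 and N ≥ 2, because N + 3 ≤ 4N.
log-≤-3log : ∀ {x N} → x ≤ N + 3 → 2 ≤ N → ⌊log₂ x ⌋ ≤ 3 * ⌊log₂ N ⌋
log-≤-3log {x} {N} x≤N+3 N≥2@(s≤s (s≤s _)) = begin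
  ⌊log₂ x ⌋               ≤⟨ ⌊log₂⌋-mono-≤ (≤-trans x≤N+3 N+3≤4N) ⟩
  ⌊log₂ (2 * (2 * N)) ⌋   ≡⟨ ⌊log₂[2*b]⌋≡1+⌊log₂b⌋ (2 * N) ⟩
  1 + ⌊log₂ (2 * N) ⌋     ≡⟨ cong (1 +_) (⌊log₂[2*b]⌋≡1+⌊log₂b⌋ N) ⟩
  2 + ⌊log₂ N ⌋           ≤⟨ +-mono-≤ lg≥1 (+-mono-≤ lg≥1 (≤-reflexive (sym (+-identityʳ _)))) ⟩
  3 * ⌊log₂ N ⌋           ∎
  where
  open ≤-Reasoning
  lg≥1 : 1 ≤ ⌊log₂ N ⌋
  lg≥1 = ⌊log₂⌋-mono-≤ N≥2
  N+3≤4N : N + 3 ≤ 2 * (2 * N)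
  N+3≤4N = ≤-trans (+-monoʳ-≤ N (*-monoʳ-≤ 3 (≤-trans (s≤s z≤n) N≥2)))
    (≤-reflexive (solve 1 (λ k → k :+ con 3 :* k := con 2 :* (con 2 :* k)) refl N))

step-cost : ∀ (Tm : ℕ → ℕ) c m₀ → (∀ x → m₀ ≤ x → Tm x ≤ c * ⌊log₂ x ⌋) →
  ∀ {x N} → x ≤ N + 3 → 2 ≤ N → suc (Tm x) ≤ suc (sum (applyUpTo Tm m₀) + 3 * c) * ⌊log₂ N ⌋
step-cost Tm c m₀ eventually {x} {N} x≤N+3 N≥2 = begin
  suc (Tm x)                  ≤⟨ s≤s (T-bound Tm c m₀ eventually x) ⟩
  suc (M + c * ⌊log₂ x ⌋)      ≤⟨ s≤s (+-monoʳ-≤ M (*-monoʳ-≤ c (log-≤-3log x≤N+3 N≥2))) ⟩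
  1 + (M + c * (3 * lg))      ≤⟨ +-mono-≤ lg≥1 (+-monoˡ-≤ _ M≤M*lg) ⟩
  lg + (M * lg + c * (3 * lg)) ≡⟨ solve 3 (λ l k a → l :+ (k :* l :+ a :* (con 3 :* l))
                                              := (con 1 :+ (k :+ con 3 :* a)) :* l) refl lg M c ⟩
  suc (M + 3 * c) * lg        ∎
  where
  open ≤-Reasoning
  M : ℕ
  M = sum (applyUpTo Tm m₀)
  lg : ℕ
  lg = ⌊log₂ N ⌋
  lg≥1 : 1 ≤ lg
  lg≥1 = ⌊log₂⌋-mono-≤ N≥2
  M≤M*lg : M ≤ M * lg
  M≤M*lg = ≤-trans (≤-reflexive (sym (*-identityʳ M))) (*-monoʳ-≤ M lg≥1)

-- Each of the at most 1 + J(K; L) ≤ 2 J(L) steps costs at most A log N.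
corollary3 : (T : ℕ → ℕ) →
    (∃ λ c → ∃ λ m₀ → ∀ m → m₀ ≤ m → T m ≤ c * ⌊log₂ m ⌋) →
    ∃ λ C → ∃ λ N₀ → ∀ h (L : LDS h) (j : ℕ) → IsJ L j → N₀ ≤ numKeys L →
      ∀ K → 0 < K → jumpCost T L K ≤ C * (j * ⌊log₂ numKeys L ⌋)
corollary3 T (c , m₀ , eventually) = 2 * A , 2 , bound
  where
  A : ℕ
  A = suc (sum (applyUpTo T m₀) + 3 * c)
  bound : ∀ h (L : LDS h) (j : ℕ) → IsJ L j → 2 ≤ numKeys L →
          ∀ K → 0 < K → jumpCost T L K ≤ (2 * A) * (j * ⌊log₂ numKeys L ⌋)
  bound h L j isJ N≥2 K K>0 = begin
    jumpCost T L K           ≤⟨ LDS-jumpCost T L (A * lg) stepBound K ⟩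
    (A * lg) * suc (JK L K)  ≤⟨ *-monoʳ-≤ (A * lg) 1+J≤2j ⟩
    (A * lg) * (2 * j)       ≡⟨ solve 3 (λ a l i → (a :* l) :* (con 2 :* i) := (con 2 :* a) :* (i :* l))
                                      refl A lg j ⟩
    (2 * A) * (j * lg)       ∎
    where
    open ≤-Reasoning
    lg : ℕ
    lg = ⌊log₂ numKeys L ⌋
    stepBound : ∀ x → x < h + 3 → suc (T x) ≤ A * lg
    stepBound x x<h+3 = step-cost T c m₀ eventually
      (s≤s⁻¹ (≤-trans x<h+3 (+-monoˡ-≤ 3 (numKeys-height L)))) N≥2
    1+J≤2j : suc (JK L K) ≤ 2 * j
    1+J≤2j = +-mono-≤ (J-pos L j isJ) (≤-trans (proj₂ isJ K K>0) (≤-reflexive (sym (+-identityʳ j))))
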